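{- Let $k$ be a field. For any $k$-diagram $\mathcal{F}$ there is an isomorphism $H^1(\mathcal{F})^*\to\operatorname{Hom}(\mathcal{F},\underline{k}_{/B_1,B_2})$ which is natural in $\mathcal{F}$: for any morphism $\mu\colon\mathcal{F}\to\mathcal{G}$ of $k$-diagrams, the map $H^1(\mathcal{G})^*\to H^1(\mathcal{F})^*$ dual to the map $H^1(\mathcal{F})\to H^1(\mathcal{G})$ induced by $\mu$ corresponds, under these isomorphisms, to the map $\operatorname{Hom}(\mathcal{G},\underline{k}_{/B_1,B_2})\to\operatorname{Hom}(\mathcal{F},\underline{k}_{/B_1,B_2})$ given by precomposition with $\mu$.
   Context: A $k$-diagram $\mathcal{F}$ consists of $k$-vector spaces $\mathcal{F}(B_1),\mathcal{F}(B_2),\mathcal{F}(B_3),\mathcal{F}(A_1),\mathcal{F}(A_2)$ and linear maps $\rho_{1,1}\colon\mathcal{F}(B_1)\to\mathcal{F}(A_1)$, $\rho_{2,2}\colon\mathcal{F}(B_2)\to\mathcal{F}(A_2)$, $\rho_{3,1}\colon\mathcal{F}(B_3)\to\mathcal{F}(A_1)$, $\rho_{3,2}\colon\mathcal{F}(B_3)\to\mathcal{F}(A_2)$. Its differential $\partial\colon\mathcal{F}(B_1)\oplus\mathcal{F}(B_2)\oplus\mathcal{F}(B_3)\to\mathcal{F}(A_1)\oplus\mathcal{F}(A_2)$ is $(b_1,b_2,b_3)\mapsto(\rho_{1,1}b_1-\rho_{3,1}b_3,\rho_{2,2}b_2-\rho_{3,2}b_3)$, $H^0(\mathcal{F})=\ker\partial$,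 $H^1(\mathcal{F})=\operatorname{coker}\partial$; $V^*$ is the full dual $\operatorname{Hom}_k(V,k)$. A morphism $\phi\colon\mathcal{F}\to\mathcal{G}$ is a family of linear maps $\phi(P)\colon\mathcal{F}(P)\to\mathcal{G}(P)$, $P\in\{A_1,A_2,B_1,B_2,B_3\}$, with $\mathcal{G}(\rho_{i,j})\phi(B_i)=\phi(A_j)\mathcal{F}(\rho_{i,j})$; $\operatorname{Hom}(\mathcal{F},\mathcal{G})$ is the $k$-vector space of morphisms. A morphism induces maps commuting with the differentials, hence maps on $H^0,H^1$. The $k$-diagram $\underline{k}_{/B_1,B_2}$ has values $0$ at $B_1,B_2$ and $k$ at $B_3,A_1,A_2$, with $\rho_{3,1},\rho_{3,2}$ the identity of $k$ (and $\rho_{1,1},\rho_{2,2}$ zero). -}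

module Defs where

open import Level using (Level; _⊔_) renaming (suc to lsuc)
open import Algebra.Bundles using (CommutativeRing)
open import Algebra.Module.Bundles using (Module)
open import Algebra.Module.Morphism.Structures using (module ModuleMorphisms)
import Algebra.Module.Construct.TensorUnit as TensorUnit
import Algebra.Module.Construct.Zero as Zero
import Algebra.Module.Morphism.Construct.Identity as MorphId
import Algebra.Module.Morphism.Construct.Composition as MorphComp
open import Data.Product using (Σ; ∃; _×_; _,_; proj₁; proj₂)
open import Relation.Nullary using (¬_)
open import Function using (_∘_; id)
import Relation.Binary.Reasoning.Setoid as SetoidReasoning

record IsField {c ℓ} (K : CommutativeRing c ℓ) : Set (c ⊔ ℓ) where
  open CommutativeRing K
  field
    1#≉0#   : ¬ (1# ≈ 0#)
    inverse : ∀ x → ¬ (x ≈ 0#) → ∃ λ y → x * y ≈ 1#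

-- Everything below is relative to a fixed commutative ring K (the field k);
-- k-vector spaces are stdlib K-modules, linear maps are stdlib module
-- homomorphisms.

module _ {c ℓ} (K : CommutativeRing c ℓ) where
  open CommutativeRing K renaming (Carrier to k)

  record LinMap {m₁ ℓ₁ m₂ ℓ₂} (V : Module K m₁ ℓ₁) (W : Module K m₂ ℓ₂)
         : Set (c ⊔ m₁ ⊔ ℓ₁ ⊔ m₂ ⊔ ℓ₂) where
    field
      fun      : Module.Carrierᴹ V → Module.Carrierᴹ W
      isLinear : ModuleMorphisms.IsModuleHomomorphism
                   (Module.rawModule V) (Module.rawModule W) fun
    open ModuleMorphisms.IsModuleHomomorphism isLinear public

  kMod : Module K c ℓ
  kMod = TensorUnit.⟨module⟩ {R = K}

  0Mod : Module K c ℓ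
  0Mod = Zero.⟨module⟩ {c} {ℓ} {R = K}

  record Diagram (m ℓm : Level) : Set (c ⊔ ℓ ⊔ lsuc (m ⊔ ℓm)) where
    field
      B₁ B₂ B₃ A₁ A₂ : Module K m ℓm
      ρ₁₁ : LinMap B₁ A₁
      ρ₂₂ : LinMap B₂ A₂
      ρ₃₁ : LinMap B₃ A₁
      ρ₃₂ : LinMap B₃ A₂

  open LinMap

  record Morphism {m₁ ℓ₁ m₂ ℓ₂} (F : Diagram m₁ ℓ₁) (G : Diagram m₂ ℓ₂)
         : Set (c ⊔ m₁ ⊔ ℓ₁ ⊔ m₂ ⊔ ℓ₂) where
    private
      module F = Diagram F
      module G = Diagram G
    field
      at-B₁ : LinMap F.B₁ G.B₁
      at-B₂ : LinMap F.B₂ G.B₂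
      at-B₃ : LinMap F.B₃ G.B₃
      at-A₁ : LinMap F.A₁ G.A₁
      at-A₂ : LinMap F.A₂ G.A₂
      comm₁₁ : ∀ x → Module._≈ᴹ_ G.A₁ (fun G.ρ₁₁ (fun at-B₁ x)) (fun at-A₁ (fun F.ρ₁₁ x))
      comm₂₂ : ∀ x → Module._≈ᴹ_ G.A₂ (fun G.ρ₂₂ (fun at-B₂ x)) (fun at-A₂ (fun F.ρ₂₂ x))
      comm₃₁ : ∀ x → Module._≈ᴹ_ G.A₁ (fun G.ρ₃₁ (fun at-B₃ x)) (fun at-A₁ (fun F.ρ₃₁ x))
      comm₃₂ : ∀ x → Module._≈ᴹ_ G.A₂ (fun G.ρ₃₂ (fun at-B₃ x)) (fun at-A₂ (fun F.ρ₃₂ x))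

  record _≈Hom_ {m₁ ℓ₁ m₂ ℓ₂} {F : Diagram m₁ ℓ₁} {G : Diagram m₂ ℓ₂}
         (φ ψ : Morphism F G) : Set (m₁ ⊔ ℓ₂) where
    private
      module F = Diagram F
      module G = Diagram G
      module φ = Morphism φ
      module ψ = Morphism ψ
    field
      eq-B₁ : ∀ x → Module._≈ᴹ_ G.B₁ (fun φ.at-B₁ x) (fun ψ.at-B₁ x)
      eq-B₂ : ∀ x → Module._≈ᴹ_ G.B₂ (fun φ.at-B₂ x) (fun ψ.at-B₂ x)
      eq-B₃ : ∀ x → Module._≈ᴹ_ G.B₃ (fun φ.at-B₃ x) (fun ψ.at-B₃ x)
      eq-A₁ : ∀ x → Module._≈ᴹ_ G.A₁ (fun φ.at-A₁ x) (fun ψ.at-A₁ x)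
      eq-A₂ : ∀ x → Module._≈ᴹ_ G.A₂ (fun φ.at-A₂ x) (fun ψ.at-A₂ x)

  record IsSumHom {m₁ ℓ₁ m₂ ℓ₂} {F : Diagram m₁ ℓ₁} {G : Diagram m₂ ℓ₂}
         (φ ψ χ : Morphism F G) : Set (m₁ ⊔ ℓ₂) where
    private
      module F = Diagram F
      module G = Diagram G
      module φ = Morphism φ
      module ψ = Morphism ψ
      module χ = Morphism χ
    field
      sum-B₁ : ∀ x → Module._≈ᴹ_ G.B₁ (fun φ.at-B₁ x) (Module._+ᴹ_ G.B₁ (fun ψ.at-B₁ x) (fun χ.at-B₁ x))
      sum-B₂ : ∀ x → Module._≈ᴹ_ G.B₂ (fun φ.at-B₂ x) (Module._+ᴹ_ G.B₂ (fun ψ.at-B₂ x) (fun χ.at-B₂ x))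
      sum-B₃ : ∀ x → Module._≈ᴹ_ G.B₃ (fun φ.at-B₃ x) (Module._+ᴹ_ G.B₃ (fun ψ.at-B₃ x) (fun χ.at-B₃ x))
      sum-A₁ : ∀ x → Module._≈ᴹ_ G.A₁ (fun φ.at-A₁ x) (Module._+ᴹ_ G.A₁ (fun ψ.at-A₁ x) (fun χ.at-A₁ x))
      sum-A₂ : ∀ x → Module._≈ᴹ_ G.A₂ (fun φ.at-A₂ x) (Module._+ᴹ_ G.A₂ (fun ψ.at-A₂ x) (fun χ.at-A₂ x))

  record IsScaleHom {m₁ ℓ₁ m₂ ℓ₂} {F : Diagram m₁ ℓ₁} {G : Diagram m₂ ℓ₂}
         (φ : Morphism F G) (r : k) (ψ : Morphism F G) : Set (m₁ ⊔ ℓ₂) where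
    private
      module F = Diagram F
      module G = Diagram G
      module φ = Morphism φ
      module ψ = Morphism ψ
    field
      scale-B₁ : ∀ x → Module._≈ᴹ_ G.B₁ (fun φ.at-B₁ x) (Module._*ₗ_ G.B₁ r (fun ψ.at-B₁ x))
      scale-B₂ : ∀ x → Module._≈ᴹ_ G.B₂ (fun φ.at-B₂ x) (Module._*ₗ_ G.B₂ r (fun ψ.at-B₂ x))
      scale-B₃ : ∀ x → Module._≈ᴹ_ G.B₃ (fun φ.at-B₃ x) (Module._*ₗ_ G.B₃ r (fun ψ.at-B₃ x))
      scale-A₁ : ∀ x → Module._≈ᴹ_ G.A₁ (fun φ.at-A₁ x) (Module._*ₗ_ G.A₁ r (fun ψ.at-A₁ x))
      scale-A₂ : ∀ x → Module._≈ᴹ_ G.A₂ (fun φ.at-A₂ x) (Module._*ₗ_ G.A₂ r (fun ψ.at-A₂ x))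

  _∘Hom_ : ∀ {m₁ ℓ₁ m₂ ℓ₂ m₃ ℓ₃} {F : Diagram m₁ ℓ₁} {G : Diagram m₂ ℓ₂} {H : Diagram m₃ ℓ₃}
           → Morphism G H → Morphism F G → Morphism F H
  _∘Hom_ {H = H} ψ φ = record
    { at-B₁ = comp ψ.at-B₁ φ.at-B₁
    ; at-B₂ = comp ψ.at-B₂ φ.at-B₂
    ; at-B₃ = comp ψ.at-B₃ φ.at-B₃
    ; at-A₁ = comp ψ.at-A₁ φ.at-A₁
    ; at-A₂ = comp ψ.at-A₂ φ.at-A₂
    ; comm₁₁ = λ x → Module.≈ᴹ-trans H.A₁ (ψ.comm₁₁ _) (⟦⟧-cong ψ.at-A₁ (φ.comm₁₁ x))
    ; comm₂₂ = λ x → Module.≈ᴹ-trans H.A₂ (ψ.comm₂₂ _) (⟦⟧-cong ψ.at-A₂ (φ.comm₂₂ x))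
    ; comm₃₁ = λ x → Module.≈ᴹ-trans H.A₁ (ψ.comm₃₁ _) (⟦⟧-cong ψ.at-A₁ (φ.comm₃₁ x))
    ; comm₃₂ = λ x → Module.≈ᴹ-trans H.A₂ (ψ.comm₃₂ _) (⟦⟧-cong ψ.at-A₂ (φ.comm₃₂ x))
    }
    where
      module ψ = Morphism ψ
      module φ = Morphism φ
      module H = Diagram H
      comp : ∀ {a b d e f g} {U : Module K a b} {V : Module K d e} {W : Module K f g}
             → LinMap V W → LinMap U V → LinMap U W
      comp {W = W} g f = record
        { fun = fun g ∘ fun f
        ; isLinear = MorphComp.isModuleHomomorphism (Module.≈ᴹ-trans W) (isLinear f) (isLinear g)
        }

  private
    idk : LinMap kMod kMod
    idk = record
      { fun = id
      ; isLinear = MorphId.isModuleHomomorphism (Module.rawModule kMod) refl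
      }

    zero→k : LinMap 0Mod kMod
    zero→k = record
      { fun = λ _ → 0#
      ; isLinear = record
        { isBimoduleHomomorphism = record
          { +ᴹ-isGroupHomomorphism = record
            { isMonoidHomomorphism = record
              { isMagmaHomomorphism = record
                { isRelHomomorphism = record { cong = λ _ → refl }
                ; homo = λ _ _ → sym (+-identityʳ 0#)
                }
              ; ε-homo = refl
              }
            ; ⁻¹-homo = λ _ → sym -0#≈0#
            }
          ; *ₗ-homo = λ r _ → sym (zeroʳ r)
          ; *ᵣ-homo = λ r _ → sym (zeroˡ r)
          }
        }
      }
      where open import Algebra.Properties.Ring ring using (-0#≈0#)

  k/B₁B₂ : Diagram c ℓ
  k/B₁B₂ = record
    { B₁ = 0Mod ; B₂ = 0Mod ; B₃ = kMod ; A₁ = kMod ; A₂ = kMod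
    ; ρ₁₁ = zero→k ; ρ₂₂ = zero→k ; ρ₃₁ = idk ; ρ₃₂ = idk
    }

  -- The differential ∂ : F(B₁) ⊕ F(B₂) ⊕ F(B₃) → F(A₁) ⊕ F(A₂),
  -- H¹(F) = coker ∂ (the quotient of F(A₁) ⊕ F(A₂) by im ∂, presented as the
  -- carrier F(A₁) × F(A₂) with the equivalence x ∼ y ⇔ x - y ∈ im ∂), and its
  -- full dual H¹(F)* = Hom_k(H¹(F), k).

  module _ {m ℓm} (F : Diagram m ℓm) where
    private
      open Diagram F
      module B₁ = Module B₁
      module B₂ = Module B₂
      module B₃ = Module B₃
      module A₁ = Module A₁
      module A₂ = Module A₂

    A⊕ : Set m
    A⊕ = A₁.Carrierᴹ × A₂.Carrierᴹ

    _≈⊕_ : A⊕ → A⊕ → Set ℓm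
    (x₁ , x₂) ≈⊕ (y₁ , y₂) = (x₁ A₁.≈ᴹ y₁) × (x₂ A₂.≈ᴹ y₂)

    _+⊕_ : A⊕ → A⊕ → A⊕
    (x₁ , x₂) +⊕ (y₁ , y₂) = (x₁ A₁.+ᴹ y₁ , x₂ A₂.+ᴹ y₂)

    _-⊕_ : A⊕ → A⊕ → A⊕
    (x₁ , x₂) -⊕ (y₁ , y₂) = (x₁ A₁.+ᴹ (A₁.-ᴹ y₁) , x₂ A₂.+ᴹ (A₂.-ᴹ y₂))

    _*⊕_ : k → A⊕ → A⊕
    r *⊕ (x₁ , x₂) = (r A₁.*ₗ x₁ , r A₂.*ₗ x₂)

    ∂ : B₁.Carrierᴹ × B₂.Carrierᴹ × B₃.Carrierᴹ → A⊕
    ∂ (b₁ , b₂ , b₃) =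
      ( fun ρ₁₁ b₁ A₁.+ᴹ (A₁.-ᴹ fun ρ₃₁ b₃)
      , fun ρ₂₂ b₂ A₂.+ᴹ (A₂.-ᴹ fun ρ₃₂ b₃) )

    _∼H¹_ : A⊕ → A⊕ → Set (m ⊔ ℓm)
    x ∼H¹ y = ∃ λ b → ∂ b ≈⊕ (x -⊕ y)

    record H¹Dual : Set (c ⊔ ℓ ⊔ m ⊔ ℓm) where
      field
        func  : A⊕ → k
        cong  : ∀ {x y} → x ∼H¹ y → func x ≈ func y
        +-hom : ∀ x y → func (x +⊕ y) ≈ func x + func y
        *-hom : ∀ r x → func (r *⊕ x) ≈ r * func x

    _≈H¹*_ : H¹Dual → H¹Dual → Set (m ⊔ ℓ)
    ξ₁ ≈H¹* ξ₂ = ∀ x → H¹Dual.func ξ₁ x ≈ H¹Dual.func ξ₂ x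

  open H¹Dual

  module _ {m₁ ℓ₁ m₂ ℓ₂} {F : Diagram m₁ ℓ₁} {G : Diagram m₂ ℓ₂} (μ : Morphism F G) where
    private
      module F = Diagram F
      module G = Diagram G
      module μ = Morphism μ
      module GA₁ = Module G.A₁
      module GA₂ = Module G.A₂

    H¹map : A⊕ F → A⊕ G
    H¹map (x₁ , x₂) = (fun μ.at-A₁ x₁ , fun μ.at-A₂ x₂)

    private
      lin-sub : ∀ {a b d e} {V : Module K a b} {W : Module K d e} (f : LinMap V W) x y →
                Module._≈ᴹ_ W (fun f (Module._+ᴹ_ V x (Module.-ᴹ_ V y)))
                              (Module._+ᴹ_ W (fun f x) (Module.-ᴹ_ W (fun f y)))
      lin-sub {W = W} f x y =
        Module.≈ᴹ-trans W (+ᴹ-homo f _ _) (Module.+ᴹ-congˡ W (-ᴹ-homo f y))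

      ∂-nat : ∀ b → _≈⊕_ G (∂ G (fun μ.at-B₁ (proj₁ b) , fun μ.at-B₂ (proj₁ (proj₂ b)) , fun μ.at-B₃ (proj₂ (proj₂ b))))
                           (H¹map (∂ F b))
      ∂-nat (b₁ , b₂ , b₃) =
          GA₁.≈ᴹ-trans (GA₁.+ᴹ-cong (μ.comm₁₁ b₁) (GA₁.-ᴹ‿cong (μ.comm₃₁ b₃)))
                       (GA₁.≈ᴹ-sym (lin-sub μ.at-A₁ _ _))
        , GA₂.≈ᴹ-trans (GA₂.+ᴹ-cong (μ.comm₂₂ b₂) (GA₂.-ᴹ‿cong (μ.comm₃₂ b₃)))
                       (GA₂.≈ᴹ-sym (lin-sub μ.at-A₂ _ _))

      H¹map-cong : ∀ {x y} → _∼H¹_ F x y → _∼H¹_ G (H¹map x) (H¹map y)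
      H¹map-cong {x₁ , x₂} {y₁ , y₂} ((b₁ , b₂ , b₃) , e₁ , e₂) =
          (fun μ.at-B₁ b₁ , fun μ.at-B₂ b₂ , fun μ.at-B₃ b₃)
        , GA₁.≈ᴹ-trans (proj₁ (∂-nat (b₁ , b₂ , b₃)))
            (GA₁.≈ᴹ-trans (⟦⟧-cong μ.at-A₁ e₁) (lin-sub μ.at-A₁ x₁ y₁))
        , GA₂.≈ᴹ-trans (proj₂ (∂-nat (b₁ , b₂ , b₃)))
            (GA₂.≈ᴹ-trans (⟦⟧-cong μ.at-A₂ e₂) (lin-sub μ.at-A₂ x₂ y₂))

      ≈⇒∼ : ∀ {x y} → _≈⊕_ G x y → _∼H¹_ G x y
      ≈⇒∼ {x₁ , x₂} {y₁ , y₂} (e₁ , e₂) =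
          (Module.0ᴹ G.B₁ , Module.0ᴹ G.B₂ , Module.0ᴹ G.B₃)
        , GA₁.≈ᴹ-trans (GA₁.+ᴹ-cong (0ᴹ-homo G.ρ₁₁) (GA₁.-ᴹ‿cong (0ᴹ-homo G.ρ₃₁)))
            (GA₁.≈ᴹ-trans (GA₁.-ᴹ‿inverseʳ GA₁.0ᴹ)
              (GA₁.≈ᴹ-sym (GA₁.≈ᴹ-trans (GA₁.+ᴹ-congʳ e₁) (GA₁.-ᴹ‿inverseʳ y₁))))
        , GA₂.≈ᴹ-trans (GA₂.+ᴹ-cong (0ᴹ-homo G.ρ₂₂) (GA₂.-ᴹ‿cong (0ᴹ-homo G.ρ₃₂)))
            (GA₂.≈ᴹ-trans (GA₂.-ᴹ‿inverseʳ GA₂.0ᴹ)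
              (GA₂.≈ᴹ-sym (GA₂.≈ᴹ-trans (GA₂.+ᴹ-congʳ e₂) (GA₂.-ᴹ‿inverseʳ y₂))))

    H¹map* : H¹Dual G → H¹Dual F
    H¹map* ξG = record
      { func  = func ξG ∘ H¹map
      ; cong  = cong ξG ∘ H¹map-cong
      ; +-hom = λ x y → trans (cong ξG (≈⇒∼ (+ᴹ-homo μ.at-A₁ _ _ , +ᴹ-homo μ.at-A₂ _ _)))
                              (+-hom ξG _ _)
      ; *-hom = λ r x → trans (cong ξG (≈⇒∼ (*ₗ-homo μ.at-A₁ r _ , *ₗ-homo μ.at-A₂ r _)))
                              (*-hom ξG r _)
      }

  record IsLinearIso {m ℓm} (F : Diagram m ℓm)
         (Φ : H¹Dual F → Morphism F k/B₁B₂) : Set (c ⊔ ℓ ⊔ m ⊔ ℓm) where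
    field
      Φ-cong : ∀ ξ₁ ξ₂ → _≈H¹*_ F ξ₁ ξ₂ → Φ ξ₁ ≈Hom Φ ξ₂
      Φ-+   : ∀ ξ ξ₁ ξ₂ → (∀ x → func ξ x ≈ func ξ₁ x + func ξ₂ x) →
              IsSumHom (Φ ξ) (Φ ξ₁) (Φ ξ₂)
      Φ-*   : ∀ r ξ ξ₁ → (∀ x → func ξ x ≈ r * func ξ₁ x) →
              IsScaleHom (Φ ξ) r (Φ ξ₁)
      Φ-injective  : ∀ ξ₁ ξ₂ → Φ ξ₁ ≈Hom Φ ξ₂ → _≈H¹*_ F ξ₁ ξ₂
      Φ-surjective : ∀ (φ : Morphism F k/B₁B₂) → ∃ λ ξ → Φ ξ ≈Hom φ

  IsNatural : ∀ {m ℓm} → (Φ : (F : Diagram m ℓm) → H¹Dual F → Morphism F k/B₁B₂) →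
              Set (c ⊔ ℓ ⊔ lsuc (m ⊔ ℓm))
  IsNatural {m} {ℓm} Φ =
    ∀ (F G : Diagram m ℓm) (μ : Morphism F G) (ξG : H¹Dual G) →
      Φ F (H¹map* μ ξG) ≈Hom (Φ G ξG ∘Hom μ)

{-# OPTIONS --safe #-}
-- A functional ξ on F(A₁) ⊕ F(A₂) that kills im ∂ is the same thing as a pair of
-- functionals x₁ ↦ ξ(x₁, 0) and x₂ ↦ -ξ(0, x₂) on F(A₁), F(A₂) such that both
-- vanish on the images of ρ₁₁, ρ₂₂ and agree on B₃ after ρ₃₁, ρ₃₂; these are exactly
-- the data of a morphism F → k_{/B₁,B₂} (its values at B₁, B₂ are forced to be 0,
-- its value at B₃ is determined). Naturality holds on the nose, since both sides
-- are computed by restricting along μ(A₁) ⊕ μ(A₂).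
module Submission where

open import Defs
open import Level using (Level)
open import Algebra.Bundles using (CommutativeRing)
open import Algebra.Module.Bundles using (Module)
open import Data.Product using (Σ; _×_; _,_)
open import Function using (_∘_)
import Relation.Binary.Reasoning.Setoid as SetoidReasoning

module _ {c ℓ} (K : CommutativeRing c ℓ) where
  open CommutativeRing K renaming (Carrier to k)
  open import Algebra.Properties.Ring ring using (-0#≈0#; -‿distribʳ-*)
  open import Algebra.Properties.AbelianGroup +-abelianGroup
    using (⁻¹-∙-comm; ⁻¹-involutive; inverseˡ-unique; x∙y⁻¹≈ε⇒x≈y)
    renaming (⁻¹-injective to -‿injective)
  open import Algebra.Properties.CommutativeSemigroup +-commutativeSemigroup
    using (interchange)
  open SetoidReasoning setoid
  open LinMap
  open H¹Dual

  -‿distrib-+ : ∀ a b → - (a + b) ≈ - a + - b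
  -‿distrib-+ a b = sym (⁻¹-∙-comm a b)

  +-sub-interchange : ∀ a b c d → (a + b) - (c + d) ≈ (a - c) + (b - d)
  +-sub-interchange a b c d = begin
    (a + b) + - (c + d)    ≈⟨ +-congˡ (-‿distrib-+ c d) ⟩
    (a + b) + (- c + - d)  ≈⟨ interchange a b (- c) (- d) ⟩
    (a - c) + (b - d)      ∎

  sub-interchange : ∀ a b c d → (a - b) - (c - d) ≈ (a - c) - (b - d)
  sub-interchange a b c d = begin
    (a + - b) + - (c + - d)    ≈⟨ +-congˡ (-‿distrib-+ c (- d)) ⟩
    (a + - b) + (- c + - - d)  ≈⟨ interchange a (- b) (- c) (- - d) ⟩
    (a + - c) + (- b + - - d)  ≈⟨ +-congˡ (⁻¹-∙-comm b (- d)) ⟩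
    (a - c) - (b - d)          ∎

  *-distribˡ-sub : ∀ r a b → r * a - r * b ≈ r * (a - b)
  *-distribˡ-sub r a b =
    trans (+-congˡ (-‿distribʳ-* r b)) (sym (distribˡ r a (- b)))

  mkLinearFunctional : ∀ {a b} (V : Module K a b) (f : Module.Carrierᴹ V → k) →
    (∀ {x y} → Module._≈ᴹ_ V x y → f x ≈ f y) →
    (∀ x y → f (Module._+ᴹ_ V x y) ≈ f x + f y) →
    (∀ r x → f (Module._*ₗ_ V r x) ≈ r * f x) →
    LinMap K V (kMod K)
  mkLinearFunctional V f f-cong f-+ f-* = record
    { fun = f
    ; isLinear = record
      { isBimoduleHomomorphism = record
        { +ᴹ-isGroupHomomorphism = record
          { isMonoidHomomorphism = record
            { isMagmaHomomorphism = record
              { isRelHomomorphism = record { cong = f-cong }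
              ; homo = f-+
              }
            ; ε-homo = f-0
            }
          ; ⁻¹-homo = λ x → inverseˡ-unique (f (V.-ᴹ x)) (f x)
              (trans (sym (f-+ _ _)) (trans (f-cong (V.-ᴹ‿inverseˡ x)) f-0))
          }
        ; *ₗ-homo = f-*
        ; *ᵣ-homo = λ r x → trans (f-cong (V.≈ᴹ-sym (V.*ₗ-*ᵣ-coincident r x)))
                              (trans (f-* r x) (*-comm r (f x)))
        }
      }
    }
    where
      module V = Module V
      f-0 : f V.0ᴹ ≈ 0#
      f-0 = trans (f-cong (V.≈ᴹ-sym (V.*ₗ-zeroˡ V.0ᴹ))) (trans (f-* 0# V.0ᴹ) (zeroˡ _))

  toZero : ∀ {a b} (V : Module K a b) → LinMap K V (0Mod K)
  toZero V = record
    { fun = λ _ → _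
    ; isLinear = record
      { isBimoduleHomomorphism = record
        { +ᴹ-isGroupHomomorphism = record
          { isMonoidHomomorphism = record
            { isMagmaHomomorphism = record
              { isRelHomomorphism = record { cong = λ _ → _ }
              ; homo = λ _ _ → _
              }
            ; ε-homo = _
            }
          ; ⁻¹-homo = λ _ → _
          }
        ; *ₗ-homo = λ _ _ → _
        ; *ᵣ-homo = λ _ _ → _
        }
      }
    }

  ⟦⟧-sub : ∀ {a b} {V : Module K a b} (f : LinMap K V (kMod K)) x y →
           fun f (Module._+ᴹ_ V x (Module.-ᴹ_ V y)) ≈ fun f x - fun f y
  ⟦⟧-sub f x y = trans (+ᴹ-homo f _ _) (+-congˡ (-ᴹ-homo f y))

  module _ {m ℓm} (F : Diagram K m ℓm) where
    open Diagram F
    private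
      module A₁ = Module A₁
      module A₂ = Module A₂

    ≈⊕⇒∼H¹ : ∀ {x y} → _≈⊕_ K F x y → _∼H¹_ K F x y
    ≈⊕⇒∼H¹ {x₁ , x₂} {y₁ , y₂} (e₁ , e₂) =
        (Module.0ᴹ B₁ , Module.0ᴹ B₂ , Module.0ᴹ B₃)
      , A₁.≈ᴹ-trans (A₁.+ᴹ-cong (0ᴹ-homo ρ₁₁) (A₁.-ᴹ‿cong (0ᴹ-homo ρ₃₁)))
          (A₁.≈ᴹ-trans (A₁.-ᴹ‿inverseʳ A₁.0ᴹ)
            (A₁.≈ᴹ-sym (A₁.≈ᴹ-trans (A₁.+ᴹ-congʳ e₁) (A₁.-ᴹ‿inverseʳ y₁))))
      , A₂.≈ᴹ-trans (A₂.+ᴹ-cong (0ᴹ-homo ρ₂₂) (A₂.-ᴹ‿cong (0ᴹ-homo ρ₃₂)))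
          (A₂.≈ᴹ-trans (A₂.-ᴹ‿inverseʳ A₂.0ᴹ)
            (A₂.≈ᴹ-sym (A₂.≈ᴹ-trans (A₂.+ᴹ-congʳ e₂) (A₂.-ᴹ‿inverseʳ y₂))))

    module _ (ξ : H¹Dual K F) where
      func-cong : ∀ {x y} → _≈⊕_ K F x y → func ξ x ≈ func ξ y
      func-cong e = cong ξ (≈⊕⇒∼H¹ e)

      func-0 : func ξ (A₁.0ᴹ , A₂.0ᴹ) ≈ 0#
      func-0 = trans (func-cong (A₁.≈ᴹ-sym (A₁.*ₗ-zeroˡ A₁.0ᴹ) , A₂.≈ᴹ-sym (A₂.*ₗ-zeroˡ A₂.0ᴹ)))
                     (trans (*-hom ξ 0# _) (zeroˡ _))

      func-split : ∀ x₁ x₂ → func ξ (x₁ , x₂) ≈ func ξ (x₁ , A₂.0ᴹ) + func ξ (A₁.0ᴹ , x₂)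
      func-split x₁ x₂ =
        trans (func-cong (A₁.≈ᴹ-sym (A₁.+ᴹ-identityʳ x₁) , A₂.≈ᴹ-sym (A₂.+ᴹ-identityˡ x₂)))
              (+-hom ξ _ _)

      func-ρ₁₁ : ∀ b → func ξ (fun ρ₁₁ b , A₂.0ᴹ) ≈ 0#
      func-ρ₁₁ b = trans (cong ξ ((b , Module.0ᴹ B₂ , Module.0ᴹ B₃)
        , A₁.+ᴹ-congˡ (A₁.-ᴹ‿cong (0ᴹ-homo ρ₃₁))
        , A₂.+ᴹ-cong (0ᴹ-homo ρ₂₂) (A₂.-ᴹ‿cong (0ᴹ-homo ρ₃₂)))) func-0

      func-ρ₂₂ : ∀ b → func ξ (A₁.0ᴹ , fun ρ₂₂ b) ≈ 0#
      func-ρ₂₂ b = trans (cong ξ ((Module.0ᴹ B₁ , b , Module.0ᴹ B₃)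
        , A₁.+ᴹ-cong (0ᴹ-homo ρ₁₁) (A₁.-ᴹ‿cong (0ᴹ-homo ρ₃₁))
        , A₂.+ᴹ-congˡ (A₂.-ᴹ‿cong (0ᴹ-homo ρ₃₂)))) func-0

      func-ρ₃ : ∀ b → func ξ (fun ρ₃₁ b , A₂.0ᴹ) + func ξ (A₁.0ᴹ , fun ρ₃₂ b) ≈ 0#
      func-ρ₃ b = begin
        func ξ (fun ρ₃₁ b , A₂.0ᴹ) + func ξ (A₁.0ᴹ , fun ρ₃₂ b)
          ≈⟨ func-split _ _ ⟨
        func ξ (fun ρ₃₁ b , fun ρ₃₂ b)
          ≈⟨ cong ξ ((Module.0ᴹ B₁ , Module.0ᴹ B₂ , b)
                    , A₁.+ᴹ-congʳ (0ᴹ-homo ρ₁₁) , A₂.+ᴹ-congʳ (0ᴹ-homo ρ₂₂)) ⟨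
        func ξ (A₁.0ᴹ , A₂.0ᴹ)
          ≈⟨ func-0 ⟩
        0# ∎

      restrict₁ : LinMap K A₁ (kMod K)
      restrict₁ = mkLinearFunctional A₁ (λ x → func ξ (x , A₂.0ᴹ))
        (λ e → func-cong (e , A₂.≈ᴹ-refl))
        (λ x y → trans (func-cong (A₁.≈ᴹ-refl , A₂.≈ᴹ-sym (A₂.+ᴹ-identityˡ A₂.0ᴹ)))
                       (+-hom ξ _ _))
        (λ r x → trans (func-cong (A₁.≈ᴹ-refl , A₂.≈ᴹ-sym (A₂.*ₗ-zeroʳ r))) (*-hom ξ r _))

      -- The sign turns the relation ξ ∘ ∂ = 0 on B₃ into a commuting square.
      restrict₂ : LinMap K A₂ (kMod K)
      restrict₂ = mkLinearFunctional A₂ (λ x → - func ξ (A₁.0ᴹ , x))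
        (λ e → -‿cong (func-cong (A₁.≈ᴹ-refl , e)))
        (λ x y → trans (-‿cong (trans (func-cong (A₁.≈ᴹ-sym (A₁.+ᴹ-identityˡ A₁.0ᴹ) , A₂.≈ᴹ-refl))
                                      (+-hom ξ _ _)))
                       (-‿distrib-+ _ _))
        (λ r x → trans (-‿cong (trans (func-cong (A₁.≈ᴹ-sym (A₁.*ₗ-zeroʳ r) , A₂.≈ᴹ-refl))
                                      (*-hom ξ r _)))
                       (-‿distribʳ-* _ _))

      restrict₃ : LinMap K B₃ (kMod K)
      restrict₃ = mkLinearFunctional B₃ (fun restrict₁ ∘ fun ρ₃₁)
        (λ e → ⟦⟧-cong restrict₁ (⟦⟧-cong ρ₃₁ e))
        (λ x y → trans (⟦⟧-cong restrict₁ (+ᴹ-homo ρ₃₁ x y)) (+ᴹ-homo restrict₁ _ _))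
        (λ r x → trans (⟦⟧-cong restrict₁ (*ₗ-homo ρ₃₁ r x)) (*ₗ-homo restrict₁ r _))

      H¹Dual→Hom : Morphism K F (k/B₁B₂ K)
      H¹Dual→Hom = record
        { at-B₁ = toZero B₁ ; at-B₂ = toZero B₂ ; at-B₃ = restrict₃
        ; at-A₁ = restrict₁ ; at-A₂ = restrict₂
        ; comm₁₁ = λ b → sym (func-ρ₁₁ b)
        ; comm₂₂ = λ b → sym (trans (-‿cong (func-ρ₂₂ b)) -0#≈0#)
        ; comm₃₁ = λ _ → refl
        ; comm₃₂ = λ b → inverseˡ-unique _ _ (func-ρ₃ b)
        }

    module _ (φ : Morphism K F (k/B₁B₂ K)) where
      private module φ = Morphism φ

      Hom→functional : A⊕ K F → k
      Hom→functional (x₁ , x₂) = fun φ.at-A₁ x₁ - fun φ.at-A₂ x₂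

      Hom→functional-cong : ∀ {x y} → _≈⊕_ K F x y → Hom→functional x ≈ Hom→functional y
      Hom→functional-cong (e₁ , e₂) = +-cong (⟦⟧-cong φ.at-A₁ e₁) (-‿cong (⟦⟧-cong φ.at-A₂ e₂))

      Hom→functional-sub : ∀ x y →
        Hom→functional (_-⊕_ K F x y) ≈ Hom→functional x - Hom→functional y
      Hom→functional-sub (x₁ , x₂) (y₁ , y₂) =
        trans (+-cong (⟦⟧-sub φ.at-A₁ x₁ y₁) (-‿cong (⟦⟧-sub φ.at-A₂ x₂ y₂)))
              (sub-interchange _ _ _ _)

      Hom→functional-∂ : ∀ b → Hom→functional (∂ K F b) ≈ 0#
      Hom→functional-∂ (b₁ , b₂ , b₃) = begin
        Hom→functional (∂ K F (b₁ , b₂ , b₃))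
          ≈⟨ +-cong (⟦⟧-sub φ.at-A₁ _ _) (-‿cong (⟦⟧-sub φ.at-A₂ _ _)) ⟩
        (fun φ.at-A₁ (fun ρ₁₁ b₁) - fun φ.at-A₁ (fun ρ₃₁ b₃))
          - (fun φ.at-A₂ (fun ρ₂₂ b₂) - fun φ.at-A₂ (fun ρ₃₂ b₃))
          ≈⟨ +-cong (+-cong (sym (φ.comm₁₁ b₁)) (-‿cong (sym (φ.comm₃₁ b₃))))
                    (-‿cong (+-cong (sym (φ.comm₂₂ b₂)) (-‿cong (sym (φ.comm₃₂ b₃))))) ⟩
        (0# - fun φ.at-B₃ b₃) - (0# - fun φ.at-B₃ b₃)
          ≈⟨ -‿inverseʳ _ ⟩
        0# ∎

      Hom→H¹Dual : H¹Dual K F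
      Hom→H¹Dual = record
        { func = Hom→functional
        ; cong = λ { {x} {y} (b , e) → x∙y⁻¹≈ε⇒x≈y _ _
            (trans (sym (Hom→functional-sub x y))
                   (trans (sym (Hom→functional-cong e)) (Hom→functional-∂ b))) }
        ; +-hom = λ _ _ → trans (+-cong (+ᴹ-homo φ.at-A₁ _ _) (-‿cong (+ᴹ-homo φ.at-A₂ _ _)))
                                (+-sub-interchange _ _ _ _)
        ; *-hom = λ r _ → trans (+-cong (*ₗ-homo φ.at-A₁ r _) (-‿cong (*ₗ-homo φ.at-A₂ r _)))
                                (*-distribˡ-sub _ _ _)
        }

      Hom→functional-A₁ : ∀ x → Hom→functional (x , A₂.0ᴹ) ≈ fun φ.at-A₁ x
      Hom→functional-A₁ x = trans (+-congˡ (trans (-‿cong (0ᴹ-homo φ.at-A₂)) -0#≈0#)) (+-identityʳ _)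

      H¹Dual→Hom∘Hom→H¹Dual : _≈Hom_ K (H¹Dual→Hom Hom→H¹Dual) φ
      H¹Dual→Hom∘Hom→H¹Dual = record
        { eq-B₁ = λ _ → _ ; eq-B₂ = λ _ → _
        ; eq-B₃ = λ x → trans (Hom→functional-A₁ (fun ρ₃₁ x)) (sym (φ.comm₃₁ x))
        ; eq-A₁ = Hom→functional-A₁
        ; eq-A₂ = λ x → trans (-‿cong (trans (+-congʳ (0ᴹ-homo φ.at-A₁)) (+-identityˡ _)))
                              (⁻¹-involutive _)
        }

    H¹Dual→Hom-isLinearIso : IsLinearIso K F H¹Dual→Hom
    H¹Dual→Hom-isLinearIso = record
      { Φ-cong = λ _ _ e → record
          { eq-B₁ = λ _ → _ ; eq-B₂ = λ _ → _
          ; eq-B₃ = λ _ → e _ ; eq-A₁ = λ _ → e _ ; eq-A₂ = λ _ → -‿cong (e _) }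
      ; Φ-+ = λ _ _ _ h → record
          { sum-B₁ = λ _ → _ ; sum-B₂ = λ _ → _
          ; sum-B₃ = λ _ → h _ ; sum-A₁ = λ _ → h _
          ; sum-A₂ = λ _ → trans (-‿cong (h _)) (-‿distrib-+ _ _) }
      ; Φ-* = λ _ _ _ h → record
          { scale-B₁ = λ _ → _ ; scale-B₂ = λ _ → _
          ; scale-B₃ = λ _ → h _ ; scale-A₁ = λ _ → h _
          ; scale-A₂ = λ _ → trans (-‿cong (h _)) (-‿distribʳ-* _ _) }
      ; Φ-injective = λ ξ₁ ξ₂ e (x₁ , x₂) → begin
          func ξ₁ (x₁ , x₂)
            ≈⟨ func-split ξ₁ x₁ x₂ ⟩
          func ξ₁ (x₁ , A₂.0ᴹ) + func ξ₁ (A₁.0ᴹ , x₂)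
            ≈⟨ +-cong (_≈Hom_.eq-A₁ e x₁) (-‿injective (_≈Hom_.eq-A₂ e x₂)) ⟩
          func ξ₂ (x₁ , A₂.0ᴹ) + func ξ₂ (A₁.0ᴹ , x₂)
            ≈⟨ func-split ξ₂ x₁ x₂ ⟨
          func ξ₂ (x₁ , x₂) ∎
      ; Φ-surjective = λ φ → Hom→H¹Dual φ , H¹Dual→Hom∘Hom→H¹Dual φ
      }

  H¹Dual→Hom-natural : ∀ {m ℓm} → IsNatural K (H¹Dual→Hom {m} {ℓm})
  H¹Dual→Hom-natural F G μ ξ = record
    { eq-B₁ = λ _ → _ ; eq-B₂ = λ _ → _
    ; eq-B₃ = λ x → func-cong G ξ (GA₁.≈ᴹ-sym (μ.comm₃₁ x) , 0ᴹ-homo μ.at-A₂)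
    ; eq-A₁ = λ _ → func-cong G ξ (GA₁.≈ᴹ-refl , 0ᴹ-homo μ.at-A₂)
    ; eq-A₂ = λ _ → -‿cong (func-cong G ξ (0ᴹ-homo μ.at-A₁ , GA₂.≈ᴹ-refl))
    }
    where
      module μ = Morphism μ
      module GA₁ = Module (Diagram.A₁ G)
      module GA₂ = Module (Diagram.A₂ G)

theorem9p1 : ∀ {c ℓ m ℓm : Level} (K : CommutativeRing c ℓ) → IsField K →
    Σ ((F : Diagram K m ℓm) → H¹Dual K F → Morphism K F (k/B₁B₂ K)) λ Φ →
    ((F : Diagram K m ℓm) → IsLinearIso K F (Φ F)) × IsNatural K Φ
theorem9p1 K _ = H¹Dual→Hom K , H¹Dual→Hom-isLinearIso K , H¹Dual→Hom-natural K
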